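{- Let $G$ be an Eulerian multigraph (finite, without loops) such that $|E(G)|$ is odd. Then $G$ is not interval colorable, i.e., there is no positive integer $t$ for which $G$ has an interval $t$-coloring.
   Context: A multigraph may have multiple edges but no loops; all multigraphs are finite. A multigraph $G$ is Eulerian if it has a closed trail containing every edge of $G$. A proper edge-coloring of $G$ assigns colors to edges so that no two adjacent edges receive the same color. For a proper edge-coloring $\alpha$ and $v\in V(G)$, $S(v,\alpha)$ denotes the set of colors of edges incident to $v$. A proper edge-coloring of $G$ with colors $1,\ldots,t$ is an interval $t$-coloring if all colors $1,\ldots,t$ are used and for every vertex $v$ the set $S(v,\alpha)$ is an interval of consecutive integers. $G$ is interval colorable if it has an interval $t$-coloring for some positive integer $t$. -}

module Defs where

open import Data.Nat using (ℕ; suc; _≤_; _<_)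
open import Data.Fin using (Fin; zero; suc; inject₁; fromℕ)
open import Data.Product using (Σ; ∃; _×_; _,_)
open import Data.Sum using (_⊎_)
open import Relation.Binary.PropositionalEquality using (_≡_; _≢_)
open import Relation.Nullary using (¬_)
open import Function.Definitions using (Injective)

-- A finite loopless multigraph with vertex set Fin n and edge set Fin m;
-- each edge has two distinct end-vertices.  Parallel edges are allowed.
record Multigraph : Set where
  field
    n     : ℕ
    m     : ℕ
    end₁  : Fin m → Fin n
    end₂  : Fin m → Fin n
    loopless : ∀ e → end₁ e ≢ end₂ e

open Multigraph public

IncidentTo : (G : Multigraph) → Fin (m G) → Fin (n G) → Set
IncidentTo G e v = (end₁ G e ≡ v) ⊎ (end₂ G e ≡ v)

Joins : (G : Multigraph) → Fin (m G) → Fin (n G) → Fin (n G) → Set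
Joins G e u v = ((end₁ G e ≡ u) × (end₂ G e ≡ v)) ⊎ ((end₁ G e ≡ v) × (end₂ G e ≡ u))

record ClosedTrail (G : Multigraph) (k : ℕ) : Set where
  field
    w     : Fin (suc k) → Fin (n G)
    es    : Fin k → Fin (m G)
    distinct : Injective _≡_ _≡_ es
    joins : ∀ (i : Fin k) → Joins G (es i) (w (inject₁ i)) (w (suc i))
    closed : w (fromℕ k) ≡ w zero

Eulerian : Multigraph → Set
Eulerian G = Σ ℕ λ k → Σ (ClosedTrail G k) λ T →
  ∀ (e : Fin (m G)) → ∃ λ (i : Fin k) → ClosedTrail.es T i ≡ e

Proper : (G : Multigraph) → (Fin (m G) → ℕ) → Set
Proper G c = ∀ (e f : Fin (m G)) (v : Fin (n G)) →
  e ≢ f → IncidentTo G e v → IncidentTo G f v → c e ≢ c f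

InS : (G : Multigraph) → (Fin (m G) → ℕ) → Fin (n G) → ℕ → Set
InS G c v x = ∃ λ e → IncidentTo G e v × c e ≡ x

IsInterval : (ℕ → Set) → Set
IsInterval S = ∀ x y z → S x → S z → x ≤ y → y ≤ z → S y

IntervalColoring : (G : Multigraph) → ℕ → (Fin (m G) → ℕ) → Set
IntervalColoring G t c =
  Proper G c
  × (∀ e → (1 ≤ c e) × (c e ≤ t))
  × (∀ x → 1 ≤ x → x ≤ t → ∃ λ e → c e ≡ x)
  × (∀ v → IsInterval (InS G c v))

IntervalColorable : Multigraph → Set
IntervalColorable G = ∃ λ t → (1 ≤ t) × ∃ λ c → IntervalColoring G t c

module Submission where

open import Defs
open import Data.Nat using (ℕ)
open import Data.Nat.Properties using ()
open import Data.Nat.Base using (_%_)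
open import Relation.Binary.PropositionalEquality using (_≡_)
open import Relation.Nullary using (¬_)

open import Data.Bool.Base using (if_then_else_)
open import Data.Nat.Base using (zero; suc; _+_; _*_; _≤_; _<_; z≤n; s≤s)
import Data.Nat.Properties as ℕ
open import Data.Fin.Base using (Fin; zero; suc; toℕ; inject₁; fromℕ)
import Data.Fin.Properties as Fin
open import Data.Product.Base using (∃; _×_; _,_; proj₁; proj₂)
open import Data.Sum.Base using (_⊎_; inj₁; inj₂)
open import Data.Empty using (⊥-elim)
open import Function.Base using (_∘_)
open import Function.Bundles using (mk⤖; _⤖_)
open import Function.Consequences.Propositional using (strictlySurjective⇒surjective)
open import Function.Properties.Bijection using (⤖⇒↔)
open import Relation.Nullary.Decidable.Core using (does; yes; no)
open import Relation.Binary.Definitions using (DecidableEquality)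
open import Relation.Binary.PropositionalEquality
  using (refl; sym; trans; cong; cong₂; subst; _≢_; module ≡-Reasoning)
open import Algebra.Properties.Semiring.Sum ℕ.+-*-semiring

-- The proof is a parity count.  At every vertex v the colours
-- form an interval of deg v consecutive integers, and deg v is even because
-- a closed trail through all edges enters and leaves v equally often.  An
-- interval of even length contains as many odd as even numbers, so exactly
-- half of the edges at v have odd colour.  Summing over all vertices, every
-- edge is counted twice on both sides, hence |E(G)| is twice the number of
-- odd-coloured edges, contradicting the oddness of |E(G)|.

δ : {A : Set} → DecidableEquality A → A → A → ℕ
δ _≟_ a b = if does (a ≟ b) then 1 else 0

δ-spec : {A : Set} (_≟_ : DecidableEquality A) (a b : A) →
         (a ≡ b × δ _≟_ a b ≡ 1) ⊎ (a ≢ b × δ _≟_ a b ≡ 0)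
δ-spec _≟_ a b with a ≟ b
... | yes a≡b = inj₁ (a≡b , refl)
... | no a≢b = inj₂ (a≢b , refl)

δᶠ : ∀ {n} → Fin n → Fin n → ℕ
δᶠ = δ Fin._≟_

δⁿ : ℕ → ℕ → ℕ
δⁿ = δ ℕ._≟_

∑-δ : ∀ {n} (a : Fin n) → ∑[ i < n ] δᶠ a i ≡ 1
∑-δ {suc n} zero = cong suc (sum-replicate-zero n)
∑-δ {suc n} (suc a) = ∑-δ a

∑-pick : ∀ T c (g : ℕ → ℕ) → c < T → ∑[ i < T ] (δⁿ c (toℕ i) * g (toℕ i)) ≡ g c
∑-pick (suc T) zero g _ = begin
  g 0 + 0 + sum {T} (λ _ → 0) ≡⟨ cong (g 0 + 0 +_) (sum-replicate-zero T) ⟩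
  g 0 + 0 + 0                 ≡⟨ ℕ.+-identityʳ _ ⟩
  g 0 + 0                     ≡⟨ ℕ.+-identityʳ _ ⟩
  g 0                         ∎
  where open ≡-Reasoning
∑-pick (suc T) (suc c) g (s≤s c<T) = ∑-pick T c (g ∘ suc) c<T

∑-nonzero : ∀ {n} (f : Fin n → ℕ) → sum f ≢ 0 → ∃ λ i → f i ≢ 0
∑-nonzero {zero} f sum≢0 with sum≢0 refl
... | ()
∑-nonzero {suc n} f sum≢0 with f zero ℕ.≟ 0
... | no f0≢0 = zero , f0≢0
... | yes f0≡0 with ∑-nonzero (f ∘ suc) (λ rest≡0 → sum≢0 (cong₂ _+_ f0≡0 rest≡0))
...   | i , fi≢0 = suc i , fi≢0

∑-fibres : ∀ {M} T (w c : Fin M → ℕ) (g : ℕ → ℕ) → (∀ e → c e < T) →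
           ∑[ e < M ] (w e * g (c e))
             ≡ ∑[ i < T ] (∑[ e < M ] (w e * δⁿ (c e) (toℕ i)) * g (toℕ i))
∑-fibres {M} T w c g c<T = begin
  ∑[ e < M ] (w e * g (c e))
    ≡⟨ sum-cong-≗ {M} (λ e → cong (w e *_) (sym (∑-pick T (c e) g (c<T e)))) ⟩
  ∑[ e < M ] (w e * ∑[ i < T ] (δⁿ (c e) (toℕ i) * g (toℕ i)))
    ≡⟨ sum-cong-≗ {M} (λ e → *-distribˡ-sum {T} (w e) (λ i → δⁿ (c e) (toℕ i) * g (toℕ i))) ⟩
  ∑[ e < M ] ∑[ i < T ] (w e * (δⁿ (c e) (toℕ i) * g (toℕ i)))
    ≡⟨ ∑-comm {M} {T} (λ e i → w e * (δⁿ (c e) (toℕ i) * g (toℕ i))) ⟩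
  ∑[ i < T ] ∑[ e < M ] (w e * (δⁿ (c e) (toℕ i) * g (toℕ i)))
    ≡⟨ sum-cong-≗ {T} (λ i → sum-cong-≗ {M} (λ e → sym (ℕ.*-assoc (w e) (δⁿ (c e) (toℕ i)) (g (toℕ i))))) ⟩
  ∑[ i < T ] ∑[ e < M ] (w e * δⁿ (c e) (toℕ i) * g (toℕ i))
    ≡⟨ sum-cong-≗ {T} (λ i → sym (*-distribʳ-sum (g (toℕ i)) (λ e → w e * δⁿ (c e) (toℕ i)))) ⟩
  ∑[ i < T ] (∑[ e < M ] (w e * δⁿ (c e) (toℕ i)) * g (toℕ i)) ∎
  where open ≡-Reasoning

∑-closed : ∀ k (f : Fin (suc k) → ℕ) → f (fromℕ k) ≡ f zero →
           ∑[ i < k ] f (suc i) ≡ ∑[ i < k ] f (inject₁ i)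
∑-closed k f closed = ℕ.+-cancelˡ-≡ (f zero) _ _ (begin
  f zero + ∑[ i < k ] f (suc i)        ≡⟨ sum-init-last f ⟩
  ∑[ i < k ] f (inject₁ i) + f (fromℕ k) ≡⟨ cong (∑[ i < k ] f (inject₁ i) +_) closed ⟩
  ∑[ i < k ] f (inject₁ i) + f zero    ≡⟨ ℕ.+-comm _ (f zero) ⟩
  f zero + ∑[ i < k ] f (inject₁ i)    ∎)
  where open ≡-Reasoning

double-even : ∀ n → (n + n) % 2 ≡ 0
double-even zero = refl
double-even (suc n) rewrite ℕ.+-suc n n = double-even n

parity-alternates : ∀ x → x % 2 + suc x % 2 ≡ 1
parity-alternates zero = refl
parity-alternates (suc zero) = refl
parity-alternates (suc (suc x)) = parity-alternates x

record IntervalIndicator (N : ℕ → ℕ) : Set where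
  field
    binary : ∀ x → N x ≡ 0 ⊎ N x ≡ 1
    convex : ∀ x y z → N x ≡ 1 → N z ≡ 1 → x ≤ y → y ≤ z → N y ≡ 1

open IntervalIndicator

count : ℕ → (ℕ → ℕ) → ℕ
count T N = ∑[ i < T ] N (toℕ i)

oddCount : ℕ → (ℕ → ℕ) → ℕ
oddCount T N = ∑[ i < T ] (N (toℕ i) * (toℕ i % 2))

evenCount : ℕ → (ℕ → ℕ) → ℕ
evenCount T N = ∑[ i < T ] (N (toℕ i) * (suc (toℕ i) % 2))

-- Translating an interval down by one gives an interval.  Note that this
-- swaps the roles of oddCount and evenCount (definitionally).
shift : ∀ {N} → IntervalIndicator N → IntervalIndicator (N ∘ suc)
shift I .binary x = binary I (suc x)
shift I .convex x y z Nx Nz x≤y y≤z = convex I (suc x) (suc y) (suc z) Nx Nz (s≤s x≤y) (s≤s y≤z)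

vanishes-after-gap : ∀ {N} → IntervalIndicator N → N 0 ≡ 1 → N 1 ≡ 0 → ∀ x → N (suc x) ≡ 0
vanishes-after-gap I N0≡1 N1≡0 x with binary I (suc x)
... | inj₁ Nx≡0 = Nx≡0
... | inj₂ Nx≡1 with trans (sym N1≡0) (convex I 0 1 (suc x) N0≡1 Nx≡1 z≤n (s≤s z≤n))
...   | ()

count-zero : ∀ T {N} → (∀ x → N x ≡ 0) → count T N ≡ 0
count-zero T N≡0 = trans (sum-cong-≗ {T} (N≡0 ∘ toℕ)) (sum-replicate-zero T)

-- By induction on T: if 0 ∉ N shift by one (swapping
-- odd and even); if 0, 1 ∈ N remove this odd/even pair and shift by two;
-- 0 ∈ N, 1 ∉ N is impossible since then the interval is {0}, of odd size.
balanced : ∀ T {N} → IntervalIndicator N → count T N % 2 ≡ 0 → oddCount T N ≡ evenCount T N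
balanced zero I ev = refl
balanced (suc T) I ev with binary I 0
... | inj₁ N0≡0 rewrite N0≡0 = sym (balanced T (shift I) ev)
balanced (suc zero) I ev | inj₂ N0≡1 rewrite N0≡1 with ev
... | ()
balanced (suc (suc T)) I ev | inj₂ N0≡1 with binary I 1
... | inj₁ N1≡0 rewrite N0≡1 | N1≡0 | count-zero T (vanishes-after-gap I N0≡1 N1≡0 ∘ suc) with ev
...   | ()
balanced (suc (suc T)) I ev | inj₂ N0≡1 | inj₂ N1≡1 rewrite N0≡1 | N1≡1 =
  cong suc (balanced T (shift (shift I)) ev)

odd+even : ∀ T N → oddCount T N + evenCount T N ≡ count T N
odd+even T N =
  trans (sym (∑-distrib-+ {T} (λ i → N (toℕ i) * (toℕ i % 2)) (λ i → N (toℕ i) * (suc (toℕ i) % 2))))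
        (sum-cong-≗ {T} (split ∘ toℕ))
  where
  split : ∀ x → N x * (x % 2) + N x * (suc x % 2) ≡ N x
  split x = begin
    N x * (x % 2) + N x * (suc x % 2) ≡⟨ sym (ℕ.*-distribˡ-+ (N x) _ _) ⟩
    N x * (x % 2 + suc x % 2)         ≡⟨ cong (N x *_) (parity-alternates x) ⟩
    N x * 1                           ≡⟨ ℕ.*-identityʳ (N x) ⟩
    N x                               ∎
    where open ≡-Reasoning

odd-half : ∀ T {N} → IntervalIndicator N → count T N % 2 ≡ 0 →
           oddCount T N + oddCount T N ≡ count T N
odd-half T {N} I ev = trans (cong (oddCount T N +_) (balanced T I ev)) (odd+even T N)

module Incidence (G : Multigraph) where
  incidence : Fin (m G) → Fin (n G) → ℕ
  incidence e v = δᶠ (end₁ G e) v + δᶠ (end₂ G e) v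

  -- Since G has no loops, at most one end of e is v.
  incidence-spec : ∀ e v → (IncidentTo G e v × incidence e v ≡ 1)
                         ⊎ (¬ IncidentTo G e v × incidence e v ≡ 0)
  incidence-spec e v with δ-spec Fin._≟_ (end₁ G e) v | δ-spec Fin._≟_ (end₂ G e) v
  ... | inj₁ (p , _) | inj₁ (q , _) = ⊥-elim (loopless G e (trans p (sym q)))
  incidence-spec e v | inj₁ (p , x) | inj₂ (_ , y) = inj₁ (inj₁ p , cong₂ _+_ x y)
  incidence-spec e v | inj₂ (_ , x) | inj₁ (q , y) = inj₁ (inj₂ q , cong₂ _+_ x y)
  incidence-spec e v | inj₂ (p , x) | inj₂ (q , y) =
    inj₂ ((λ { (inj₁ r) → p r ; (inj₂ r) → q r }) , cong₂ _+_ x y)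

  degree : Fin (n G) → ℕ
  degree v = ∑[ e < m G ] incidence e v

  ∑-incidence : ∀ e → ∑[ v < n G ] incidence e v ≡ 2
  ∑-incidence e = trans (∑-distrib-+ (δᶠ (end₁ G e)) (δᶠ (end₂ G e)))
    (cong₂ _+_ (∑-δ (end₁ G e)) (∑-δ (end₂ G e)))

  handshake : ∀ (h : Fin (m G) → ℕ) →
              ∑[ v < n G ] ∑[ e < m G ] (incidence e v * h e) ≡ 2 * ∑[ e < m G ] h e
  handshake h = begin
    ∑[ v < n G ] ∑[ e < m G ] (incidence e v * h e)  ≡⟨ ∑-comm (λ v e → incidence e v * h e) ⟩
    ∑[ e < m G ] ∑[ v < n G ] (incidence e v * h e)  ≡⟨ sum-cong-≗ {m G} (λ e → sym (*-distribʳ-sum (h e) (λ v → incidence e v))) ⟩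
    ∑[ e < m G ] (∑[ v < n G ] incidence e v * h e)  ≡⟨ sum-cong-≗ {m G} (λ e → cong (_* h e) (∑-incidence e)) ⟩
    ∑[ e < m G ] (2 * h e)                          ≡⟨ sym (*-distribˡ-sum 2 h) ⟩
    2 * ∑[ e < m G ] h e                            ∎
    where open ≡-Reasoning

  degree-sum : ∑[ v < n G ] degree v ≡ 2 * m G
  degree-sum = begin
    ∑[ v < n G ] degree v                             ≡⟨ sum-cong-≗ {n G} (λ v → sum-cong-≗ {m G} (λ e → sym (ℕ.*-identityʳ (incidence e v)))) ⟩
    ∑[ v < n G ] ∑[ e < m G ] (incidence e v * 1)     ≡⟨ handshake (λ _ → 1) ⟩
    2 * ∑[ e < m G ] 1                                ≡⟨ cong (2 *_) (∑-ones (m G)) ⟩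
    2 * m G                                           ∎
    where
    open ≡-Reasoning
    ∑-ones : ∀ k → ∑[ i < k ] 1 ≡ k
    ∑-ones zero = refl
    ∑-ones (suc k) = cong suc (∑-ones k)

  half-weight : ∀ (h : Fin (m G) → ℕ) →
                (∀ v → ∑[ e < m G ] (incidence e v * h e) + ∑[ e < m G ] (incidence e v * h e) ≡ degree v) →
                ∑[ e < m G ] h e + ∑[ e < m G ] h e ≡ m G
  half-weight h halves = ℕ.*-cancelˡ-≡ (H + H) (m G) 2 (begin
    2 * (H + H)                       ≡⟨ ℕ.*-distribˡ-+ 2 H H ⟩
    2 * H + 2 * H                     ≡⟨ cong₂ _+_ (sym (handshake h)) (sym (handshake h)) ⟩
    ∑[ v < n G ] W v + ∑[ v < n G ] W v ≡⟨ sym (∑-distrib-+ {n G} W W) ⟩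
    ∑[ v < n G ] (W v + W v)           ≡⟨ sum-cong-≗ {n G} halves ⟩
    ∑[ v < n G ] degree v              ≡⟨ degree-sum ⟩
    2 * m G                           ∎)
    where
    open ≡-Reasoning
    H : ℕ
    H = ∑[ e < m G ] h e
    W : Fin (n G) → ℕ
    W v = ∑[ e < m G ] (incidence e v * h e)

  -- Along a closed trail every vertex is entered as often as it is left:
  -- the trail edges at v number twice the visits of the trail to v.
  closed-trail-degree : ∀ {k} (trail : ClosedTrail G k) v →
    ∑[ i < k ] incidence (ClosedTrail.es trail i) v
      ≡ ∑[ i < k ] δᶠ (ClosedTrail.w trail (inject₁ i)) v + ∑[ i < k ] δᶠ (ClosedTrail.w trail (inject₁ i)) v
  closed-trail-degree {k} trail v = begin
    ∑[ i < k ] incidence (es i) v                        ≡⟨ sum-cong-≗ {k} ends ⟩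
    ∑[ i < k ] (at-v (inject₁ i) + at-v (suc i))         ≡⟨ ∑-distrib-+ {k} (at-v ∘ inject₁) (at-v ∘ suc) ⟩
    ∑[ i < k ] at-v (inject₁ i) + ∑[ i < k ] at-v (suc i) ≡⟨ cong (∑[ i < k ] at-v (inject₁ i) +_) (∑-closed k at-v (cong (λ u → δᶠ u v) closed)) ⟩
    ∑[ i < k ] at-v (inject₁ i) + ∑[ i < k ] at-v (inject₁ i) ∎
    where
    open ≡-Reasoning
    open ClosedTrail trail
    at-v : Fin (suc k) → ℕ
    at-v j = δᶠ (w j) v
    ends : ∀ i → incidence (es i) v ≡ at-v (inject₁ i) + at-v (suc i)
    ends i with joins i
    ... | inj₁ (p , q) = cong₂ (λ a b → δᶠ a v + δᶠ b v) p q
    ... | inj₂ (p , q) = trans (cong₂ (λ a b → δᶠ a v + δᶠ b v) p q) (ℕ.+-comm (at-v (suc i)) _)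

  -- In an Eulerian multigraph every vertex has even degree, since the
  -- Euler trail enumerates the edges bijectively.
  eulerian-degree-even : Eulerian G → ∀ v → degree v % 2 ≡ 0
  eulerian-degree-even (k , trail , covers) v = begin
    degree v % 2                         ≡⟨ cong (_% 2) (∑-permute (λ e → incidence e v) (⤖⇒↔ enumeration)) ⟩
    (∑[ i < k ] incidence (es i) v) % 2  ≡⟨ cong (_% 2) (closed-trail-degree trail v) ⟩
    (visits + visits) % 2                ≡⟨ double-even visits ⟩
    0                                    ∎
    where
    open ≡-Reasoning
    open ClosedTrail trail
    enumeration : Fin k ⤖ Fin (m G)
    enumeration = mk⤖ (distinct , strictlySurjective⇒surjective covers)
    visits : ℕ
    visits = ∑[ i < k ] δᶠ (w (inject₁ i)) v

module Colouring (G : Multigraph) (t : ℕ) (c : Fin (m G) → ℕ)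
                 (colouring : IntervalColoring G t c) where
  open Incidence G

  private
    proper : Proper G c
    proper = proj₁ colouring
    colours-below : ∀ e → c e < suc t
    colours-below e = s≤s (proj₂ (proj₁ (proj₂ colouring) e))
    intervals : ∀ v → IsInterval (InS G c v)
    intervals = proj₂ (proj₂ (proj₂ colouring))

  multiplicity : Fin (n G) → ℕ → ℕ
  multiplicity v x = ∑[ e < m G ] (incidence e v * δⁿ (c e) x)

  -- By properness, a colour present at v is carried by exactly one edge.
  multiplicity-present : ∀ v x → InS G c v x → multiplicity v x ≡ 1
  multiplicity-present v x (e₀ , e₀-at-v , ce₀≡x) =
    trans (sum-cong-≗ {m G} only-e₀) (∑-δ e₀)
    where
    only-e₀ : ∀ e → incidence e v * δⁿ (c e) x ≡ δᶠ e₀ e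
    only-e₀ e with δ-spec Fin._≟_ e₀ e | incidence-spec e v | δ-spec ℕ._≟_ (c e) x
    ... | inj₁ (refl , δ≡1) | inj₁ (_ , inc≡1) | inj₁ (_ , δc≡1) = trans (cong₂ _*_ inc≡1 δc≡1) (sym δ≡1)
    ... | inj₁ (refl , _) | inj₁ _ | inj₂ (ce₀≢x , _) = ⊥-elim (ce₀≢x ce₀≡x)
    ... | inj₁ (refl , _) | inj₂ (not-at-v , _) | _ = ⊥-elim (not-at-v e₀-at-v)
    ... | inj₂ (_ , δ≡0) | inj₂ (_ , inc≡0) | _ = trans (cong (_* δⁿ (c e) x) inc≡0) (sym δ≡0)
    ... | inj₂ (e₀≢e , _) | inj₁ (e-at-v , _) | inj₁ (ce≡x , _) =
      ⊥-elim (proper e₀ e v e₀≢e e₀-at-v e-at-v (trans ce₀≡x (sym ce≡x)))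
    ... | inj₂ (_ , δ≡0) | inj₁ (_ , inc≡1) | inj₂ (_ , δc≡0) = trans (cong₂ _*_ inc≡1 δc≡0) (sym δ≡0)

  multiplicity-nonzero : ∀ v x → multiplicity v x ≢ 0 → InS G c v x
  multiplicity-nonzero v x mult≢0 with ∑-nonzero (λ e → incidence e v * δⁿ (c e) x) mult≢0
  ... | e , term≢0 with incidence-spec e v | δ-spec ℕ._≟_ (c e) x
  ...   | inj₁ (e-at-v , _) | inj₁ (ce≡x , _) = e , e-at-v , ce≡x
  ...   | inj₁ (_ , inc≡1) | inj₂ (_ , δc≡0) = ⊥-elim (term≢0 (cong₂ _*_ inc≡1 δc≡0))
  ...   | inj₂ (_ , inc≡0) | _ = ⊥-elim (term≢0 (cong (_* δⁿ (c e) x) inc≡0))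

  profile : ∀ v → IntervalIndicator (multiplicity v)
  profile v .binary x with multiplicity v x ℕ.≟ 0
  ... | yes mult≡0 = inj₁ mult≡0
  ... | no mult≢0 = inj₂ (multiplicity-present v x (multiplicity-nonzero v x mult≢0))
  profile v .convex x y z mx mz x≤y y≤z =
    multiplicity-present v y (intervals v x y z (present mx) (present mz) x≤y y≤z)
    where
    present : ∀ {u} → multiplicity v u ≡ 1 → InS G c v u
    present {u} mu≡1 = multiplicity-nonzero v u (λ mu≡0 → ℕ.1+n≢0 (trans (sym mu≡1) mu≡0))

  oddDegree : Fin (n G) → ℕ
  oddDegree v = ∑[ e < m G ] (incidence e v * (c e % 2))

  odd-edges-half : ∀ v → degree v % 2 ≡ 0 → oddDegree v + oddDegree v ≡ degree v
  odd-edges-half v even = begin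
    oddDegree v + oddDegree v        ≡⟨ cong₂ _+_ oddDegree≡ oddDegree≡ ⟩
    oddCount (suc t) (multiplicity v) + oddCount (suc t) (multiplicity v)
                                     ≡⟨ odd-half (suc t) (profile v) (subst (λ d → d % 2 ≡ 0) degree≡ even) ⟩
    count (suc t) (multiplicity v)   ≡⟨ sym degree≡ ⟩
    degree v                         ∎
    where
    open ≡-Reasoning
    oddDegree≡ : oddDegree v ≡ oddCount (suc t) (multiplicity v)
    oddDegree≡ = ∑-fibres (suc t) (λ e → incidence e v) c (_% 2) colours-below
    degree≡ : degree v ≡ count (suc t) (multiplicity v)
    degree≡ = begin
      degree v                                                    ≡⟨ sum-cong-≗ {m G} (λ e → sym (ℕ.*-identityʳ (incidence e v))) ⟩
      ∑[ e < m G ] (incidence e v * 1)                             ≡⟨ ∑-fibres (suc t) (λ e → incidence e v) c (λ _ → 1) colours-below ⟩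
      ∑[ i < suc t ] (multiplicity v (toℕ i) * 1)                 ≡⟨ sum-cong-≗ {suc t} (λ i → ℕ.*-identityʳ (multiplicity v (toℕ i))) ⟩
      count (suc t) (multiplicity v)                              ∎

theorem2 : (G : Multigraph) → Eulerian G → m G % 2 ≡ 1 → ¬ IntervalColorable G
theorem2 G eulerian m-odd (t , _ , c , colouring) = ℕ.1+n≢0 (begin
  1                    ≡⟨ sym m-odd ⟩
  m G % 2              ≡⟨ cong (_% 2) (sym edges≡odd+odd) ⟩
  (odd + odd) % 2      ≡⟨ double-even odd ⟩
  0                    ∎)
  where
  open ≡-Reasoning
  open Incidence G
  open Colouring G t c colouring
  odd : ℕ
  odd = ∑[ e < m G ] (c e % 2)
  edges≡odd+odd : odd + odd ≡ m G
  edges≡odd+odd = half-weight (λ e → c e % 2) (λ v → odd-edges-half v (eulerian-degree-even eulerian v))
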